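{- Let $A$ be a residuated lattice and $(L,\lambda)$ a reticulation of $A$. Then for any filters $F,G$ of $A$, we have $\lambda(F)=\lambda(G)$ if and only if $F=G$.
   Context: A residuated lattice is an algebra $(A,\vee,\wedge,\odot,\rightarrow,0,1)$ such that $(A,\vee,\wedge,0,1)$ is a bounded lattice, $(A,\odot,1)$ is a commutative monoid, and for all $a,b,c\in A$: $a\le b\rightarrow c$ iff $a\odot b\le c$. Write $a^n=a\odot\cdots\odot a$ ($n$ factors). A filter of $A$ is a nonempty $F\subseteq A$ closed under $\odot$ and upward closed. A reticulation of $A$ is a pair $(L,\lambda)$ with $L$ a bounded distributive lattice and $\lambda:A\to L$ a function such that: (1) $\lambda(a\odot b)=\lambda(a)\wedge\lambda(b)$; (2) $\lambda(a\vee b)=\lambda(a)\vee\lambda(b)$; (3) $\lambda(0)=0$, $\lambda(1)=1$; (4) $\lambda$ is surjective; (5) $\lambda(a)\le\lambda(b)$ iff there is $n\ge 1$ with $a^n\le b$ (for all $a,b\in A$). -}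

module Defs where

open import Level using (Level; _⊔_; suc)
open import Data.Nat using (ℕ) renaming (suc to sucℕ; zero to zeroℕ)
open import Data.Product using (Σ; ∃; _×_; _,_)
open import Relation.Binary.PropositionalEquality using (_≡_)

record IsBoundedLattice {a} (A : Set a) (_∨_ _∧_ : A → A → A) (⊥ ⊤ : A) : Set a where
  field
    ∨-comm    : ∀ x y → (x ∨ y) ≡ (y ∨ x)
    ∨-assoc   : ∀ x y z → ((x ∨ y) ∨ z) ≡ (x ∨ (y ∨ z))
    ∧-comm    : ∀ x y → (x ∧ y) ≡ (y ∧ x)
    ∧-assoc   : ∀ x y z → ((x ∧ y) ∧ z) ≡ (x ∧ (y ∧ z))
    ∨-absorbs-∧ : ∀ x y → (x ∨ (x ∧ y)) ≡ x
    ∧-absorbs-∨ : ∀ x y → (x ∧ (x ∨ y)) ≡ x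
    ⊥-least   : ∀ x → (⊥ ∧ x) ≡ ⊥
    ⊤-greatest : ∀ x → (x ∧ ⊤) ≡ x

record ResiduatedLattice (a : Level) : Set (suc a) where
  infixr 6 _∨_
  infixr 7 _∧_
  infixr 7 _⊙_
  infixr 5 _⇒_
  infix 4 _≤_
  field
    Carrier : Set a
    _∨_ _∧_ _⊙_ _⇒_ : Carrier → Carrier → Carrier
    𝟘 𝟙 : Carrier
    isBoundedLattice : IsBoundedLattice Carrier _∨_ _∧_ 𝟘 𝟙
    ⊙-assoc : ∀ x y z → ((x ⊙ y) ⊙ z) ≡ (x ⊙ (y ⊙ z))
    ⊙-comm  : ∀ x y → (x ⊙ y) ≡ (y ⊙ x)
    ⊙-identityʳ : ∀ x → (x ⊙ 𝟙) ≡ x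

  _≤_ : Carrier → Carrier → Set a
  x ≤ y = (x ∧ y) ≡ x

  field
    residuation-to   : ∀ x y z → x ≤ (y ⇒ z) → (x ⊙ y) ≤ z
    residuation-from : ∀ x y z → (x ⊙ y) ≤ z → x ≤ (y ⇒ z)

  -- x ^ n = x ⊙ ⋯ ⊙ x (n factors), for n ≥ 1: pow x n = x^(n+1)
  pow : Carrier → ℕ → Carrier
  pow x zeroℕ = x
  pow x (sucℕ n) = x ⊙ pow x n

  record IsFilter {ℓ} (F : Carrier → Set ℓ) : Set (a ⊔ ℓ) where
    field
      nonempty : Σ Carrier F
      ⊙-closed : ∀ {x y} → F x → F y → F (x ⊙ y)
      up-closed : ∀ {x y} → F x → x ≤ y → F y

record BoundedDistributiveLattice (b : Level) : Set (suc b) where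
  infixr 6 _∨_
  infixr 7 _∧_
  field
    Carrier : Set b
    _∨_ _∧_ : Carrier → Carrier → Carrier
    ⊥ ⊤ : Carrier
    isBoundedLattice : IsBoundedLattice Carrier _∨_ _∧_ ⊥ ⊤
    ∧-distribˡ-∨ : ∀ x y z → (x ∧ (y ∨ z)) ≡ ((x ∧ y) ∨ (x ∧ z))

  _≤_ : Carrier → Carrier → Set b
  x ≤ y = (x ∧ y) ≡ x

record IsReticulation {a b} (A : ResiduatedLattice a) (L : BoundedDistributiveLattice b)
       (λ' : ResiduatedLattice.Carrier A → BoundedDistributiveLattice.Carrier L) : Set (a ⊔ b) where
  private
    module A = ResiduatedLattice A
    module L = BoundedDistributiveLattice L
  field
    pres-⊙ : ∀ x y → λ' (x A.⊙ y) ≡ (λ' x L.∧ λ' y)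
    pres-∨ : ∀ x y → λ' (x A.∨ y) ≡ (λ' x L.∨ λ' y)
    pres-𝟘 : λ' A.𝟘 ≡ L.⊥
    pres-𝟙 : λ' A.𝟙 ≡ L.⊤
    surjective : ∀ l → ∃ λ x → λ' x ≡ l
    order-to   : ∀ x y → λ' x L.≤ λ' y → ∃ λ n → A.pow x n A.≤ y
    order-from : ∀ x y → (∃ λ n → A.pow x n A.≤ y) → λ' x L.≤ λ' y

_⊆_ : ∀ {a ℓ₁ ℓ₂} {X : Set a} → (X → Set ℓ₁) → (X → Set ℓ₂) → Set (a ⊔ ℓ₁ ⊔ ℓ₂)
P ⊆ Q = ∀ x → P x → Q x

_≐_ : ∀ {a ℓ₁ ℓ₂} {X : Set a} → (X → Set ℓ₁) → (X → Set ℓ₂) → Set (a ⊔ ℓ₁ ⊔ ℓ₂)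
P ≐ Q = (P ⊆ Q) × (Q ⊆ P)

image : ∀ {a b ℓ} {X : Set a} {Y : Set b} → (X → Y) → (X → Set ℓ) → (Y → Set (a ⊔ b ⊔ ℓ))
image {X = X} f P y = Σ X λ x → P x × (f x ≡ y)

-- λ is order-reflecting up to powers: λ(y) ≤ λ(x) gives yⁿ ≤ x for some n.
-- So if λ(x) = λ(y) with y in a filter G, then yⁿ ∈ G and hence x ∈ G; thus
-- λ(F) ⊆ λ(G) already forces F ⊆ G, while the converse holds for any map.
module Submission where

open import Defs
open import Function.Bundles using (_⇔_; mk⇔)
open import Data.Nat using (zero; suc)
open import Data.Product using (_,_; map)
open import Relation.Binary.PropositionalEquality using (_≡_; refl; sym; trans; cong; subst)

∧-idem : ∀ {a} {X : Set a} {_∨_ _∧_ : X → X → X} {⊥ ⊤ : X} →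
         IsBoundedLattice X _∨_ _∧_ ⊥ ⊤ → ∀ x → (x ∧ x) ≡ x
∧-idem {_∨_ = _∨_} {_∧_} L x =
  trans (cong (x ∧_) (sym (∨-absorbs-∧ x x))) (∧-absorbs-∨ x (x ∧ x))
  where open IsBoundedLattice L

image-mono : ∀ {a b ℓ₁ ℓ₂} {X : Set a} {Y : Set b} (f : X → Y)
             {P : X → Set ℓ₁} {Q : X → Set ℓ₂} → P ⊆ Q → image f P ⊆ image f Q
image-mono f P⊆Q y (x , px , fx≡y) = x , P⊆Q x px , fx≡y

module _ {a} (A : ResiduatedLattice a) where
  open ResiduatedLattice A

  pow-closed : ∀ {ℓ} {F : Carrier → Set ℓ} → IsFilter F → ∀ {x} → F x → ∀ n → F (pow x n)
  pow-closed F-filter Fx zero    = Fx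
  pow-closed F-filter Fx (suc n) = IsFilter.⊙-closed F-filter Fx (pow-closed F-filter Fx n)

module _ {a b} {A : ResiduatedLattice a} {L : BoundedDistributiveLattice b}
         {λ' : ResiduatedLattice.Carrier A → BoundedDistributiveLattice.Carrier L}
         (reticulation : IsReticulation A L λ') where
  open ResiduatedLattice A using (IsFilter)
  private module L = BoundedDistributiveLattice L

  image-reflects-⊆ : ∀ {ℓ₁ ℓ₂} {P : _ → Set ℓ₁} {G : _ → Set ℓ₂} →
                     IsFilter G → image λ' P ⊆ image λ' G → P ⊆ G
  image-reflects-⊆ G-filter λP⊆λG x Px with λP⊆λG (λ' x) (x , Px , refl)
  ... | y , Gy , λy≡λx
    with IsReticulation.order-to reticulation y x λy≤λx
    where
      λy≤λx : (λ' y L.∧ λ' x) ≡ λ' y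
      λy≤λx = subst (λ z → (λ' y L.∧ z) ≡ λ' y) λy≡λx (∧-idem L.isBoundedLattice (λ' y))
  ... | n , yⁿ≤x = IsFilter.up-closed G-filter (pow-closed A G-filter Gy n) yⁿ≤x

mainTheorem1 : ∀ {a b ℓ} (A : ResiduatedLattice a) (L : BoundedDistributiveLattice b)
    (λ' : ResiduatedLattice.Carrier A → BoundedDistributiveLattice.Carrier L)
    → IsReticulation A L λ'
    → (F G : ResiduatedLattice.Carrier A → Set ℓ)
    → ResiduatedLattice.IsFilter A F
    → ResiduatedLattice.IsFilter A G
    → (image λ' F ≐ image λ' G) ⇔ (F ≐ G)
mainTheorem1 A L λ' reticulation F G F-filter G-filter = mk⇔
  (map (image-reflects-⊆ reticulation G-filter) (image-reflects-⊆ reticulation F-filter))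
  (map (image-mono λ') (image-mono λ'))
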